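{- In the setting described in the context, for any integers $u,v$ with $d\nmid v$, there exists $k_{u,v}\in K$ such that $a^ub^v$ is conjugate in $G(a,b)$ to $k_{u,v}b^v$.
   Context: Let $p\geq5$ be a prime and $G\leq\mathrm{Sym}(\Omega)$ transitive with $|\Omega|=3p$, whose only non-trivial $G$-invariant partition is $\mathcal{B}=\{B_1,\dots,B_p\}$, $B_i=\{x_i,y_i,z_i\}$. Let $\overline{G}\leq\mathrm{Sym}(\mathcal{B})$ be the induced group and $K=\ker(G\to\overline{G})$. Assume $K\neq1$, $K$ contains no derangement (every element of $K$ fixes a point), every minimal normal subgroup of $G$ contained in $K$ is an elementary abelian $3$-group, and $K$ contains no involution. Assume $\overline{G}$ is solvable and non-cyclic: $\overline{G}=\langle\alpha\rangle\rtimes\langle\beta\rangle\leq\mathrm{AGL}(1,p)$ with $\alpha=(B_1\,B_2\,\cdots\,B_p)$, $o(\beta)=d$, $d\mid p-1$, $\beta$ fixing $B_1$, $\beta\alpha\beta^{ -1}=\alpha^t$ with $\gcd(t,p)=1$, and assume $d$ is even. Let $a=(x_1\,\cdots\,x_p)(y_1\,\cdots\,y_p)(z_1\,\cdots\,z_p)\in G$ (with image $\alpha$) and $b\in G$ with image $\beta$, and assume the restriction of $b$ to $B_1$ is a transposition. Let $G(a,b)=\langle K,a,b\rangle$. -}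

module Defs where

open import Level using (0ℓ)
open import Data.Nat using (ℕ; zero; suc; _+_; _*_; _∸_; _≤_; _<_; NonZero)
open import Data.Nat.DivMod using (_mod_)
open import Data.Nat.Divisibility using () renaming (_∣_ to _∣ℕ_)
open import Data.Nat.Primality using (Prime)
open import Data.Nat.Coprimality using (Coprime)
open import Data.Integer using (ℤ; +_; -[1+_])
open import Data.Fin using (Fin; toℕ) renaming (zero to f0; suc to fsuc)
open import Data.Product using (Σ; ∃; ∃-syntax; _×_; _,_; proj₁; proj₂)
open import Data.Sum using (_⊎_)
open import Relation.Nullary using (¬_)
open import Relation.Binary.PropositionalEquality using (_≡_; _≢_)
open import Relation.Binary.Structures using (IsEquivalence)

-- The set Ω = {x_i, y_i, z_i : 1 ≤ i ≤ p} of size 3p.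
-- A point is (c , i) with c : Fin 3 (x ↦ 0, y ↦ 1, z ↦ 2) and
-- i : Fin p the block index (block B_{i+1}; block index 0 is B_1).

Pt : ℕ → Set
Pt p = Fin 3 × Fin p

Map : ℕ → Set
Map p = Pt p → Pt p

_∘_ : ∀ {A : Set} → (A → A) → (A → A) → (A → A)
(f ∘ g) x = f (g x)

idM : ∀ {A : Set} → A → A
idM x = x

_≈_ : ∀ {A : Set} → (A → A) → (A → A) → Set
f ≈ g = ∀ x → f x ≡ g x

infixr 9 _∘_
infix 4 _≈_

_^_ : ∀ {A : Set} → (A → A) → ℕ → (A → A)
f ^ zero = idM
f ^ suc n = f ∘ (f ^ n)

zpow : ∀ {A : Set} → (A → A) → (A → A) → ℤ → (A → A)
zpow f finv (+ n) = f ^ n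
zpow f finv -[1+ n ] = finv ^ suc n

IsInverse : ∀ {A : Set} → (A → A) → (A → A) → Set
IsInverse f g = (g ∘ f ≈ idM) × (f ∘ g ≈ idM)

IsPerm : ∀ {A : Set} → (A → A) → Set
IsPerm f = ∃[ g ] IsInverse f g

record IsSubgroup {A : Set} (H : (A → A) → Set) : Set where
  field
    resp  : ∀ {f g} → H f → f ≈ g → H g
    perm  : ∀ {f} → H f → IsPerm f
    one   : H idM
    mul   : ∀ {f g} → H f → H g → H (f ∘ g)
    inv   : ∀ {f g} → H f → IsInverse f g → H g

_⊆_ : ∀ {A : Set} → ((A → A) → Set) → ((A → A) → Set) → Set
H ⊆ L = ∀ f → H f → L f

record IsNormalSubgroup {A : Set} (G N : (A → A) → Set) : Set where
  field
    subgroup : IsSubgroup N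
    inG      : N ⊆ G
    normal   : ∀ g h n → G g → IsInverse g h → N n → N (g ∘ n ∘ h)

Nontrivial : ∀ {A : Set} → ((A → A) → Set) → Set
Nontrivial N = ∃[ n ] (N n × ¬ (n ≈ idM))

IsMinimalNormal : ∀ {A : Set} → ((A → A) → Set) → ((A → A) → Set) → Set₁
IsMinimalNormal {A} G N =
  IsNormalSubgroup G N × Nontrivial N ×
  ¬ (Σ ((A → A) → Set) λ M →
       IsNormalSubgroup G M × M ⊆ N × Nontrivial M × ∃[ n ] (N n × ¬ M n))

IsElemAb3 : ∀ {A : Set} → ((A → A) → Set) → Set
IsElemAb3 N = (∀ m n → N m → N n → m ∘ n ≈ n ∘ m)
            × (∀ n → N n → n ∘ n ∘ n ≈ idM)

data Gen {A : Set} (S : (A → A) → Set) : (A → A) → Set where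
  gen  : ∀ {f} → S f → Gen S f
  one  : Gen S idM
  mul  : ∀ {f g} → Gen S f → Gen S g → Gen S (f ∘ g)
  inv  : ∀ {f g} → Gen S f → IsInverse f g → Gen S g
  resp : ∀ {f g} → Gen S f → f ≈ g → Gen S g

blk : ∀ {p} → Pt p → Fin p
blk = proj₂

SameBlock : ∀ {p} → Pt p → Pt p → Set
SameBlock x y = blk x ≡ blk y

-- Induced action on blocks:  ḡ(B_i) = block containing g(x_i).
bar : ∀ {p} → Map p → Fin p → Fin p
bar g i = blk (g (f0 , i))

IsGInvPartition : ∀ {p} → (Map p → Set) → (Pt p → Pt p → Set) → Set
IsGInvPartition G R =
  IsEquivalence R × (∀ g x y → G g → R x y → R (g x) (g y))

NontrivialPartition : ∀ {p} → (Pt p → Pt p → Set) → Set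
NontrivialPartition R = ¬ (∀ x y → R x y) × ¬ (∀ x y → R x y → x ≡ y)

module _ (p : ℕ) .{{_ : NonZero p}} where

  affine : ℕ → ℕ → Fin p → Fin p
  affine m c i = (m * toℕ i + c) mod p

  α : Fin p → Fin p
  α i = (suc (toℕ i)) mod p

  a : Map p
  a (c , i) = (c , α i)

  a⁻¹ : Map p
  a⁻¹ (c , i) = (c , (toℕ i + (p ∸ 1)) mod p)

HasOrder : ∀ {A : Set} → (A → A) → ℕ → Set
HasOrder f d = (0 < d) × (f ^ d ≈ idM) × (∀ k → 0 < k → k < d → ¬ (f ^ k ≈ idM))

RestrB1Transposition : ∀ {p} .{{_ : NonZero p}} → Map p → Set
RestrB1Transposition {p} b =
  ∃[ c₁ ] ∃[ c₂ ] ∃[ c₃ ]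
    (c₁ ≢ c₂) × (c₁ ≢ c₃) × (c₂ ≢ c₃) ×
    (b (c₁ , 0 mod p) ≡ (c₂ , 0 mod p)) ×
    (b (c₂ , 0 mod p) ≡ (c₁ , 0 mod p)) ×
    (b (c₃ , 0 mod p) ≡ (c₃ , 0 mod p))

record Setting (p : ℕ) .{{_ : NonZero p}} (G : Map p → Set)
               (b b⁻¹ : Map p) (β : Fin p → Fin p) (d t : ℕ) : Set₁ where
  field
    p-prime    : Prime p
    p≥5        : 5 ≤ p
    G-subgroup : IsSubgroup G
    transitive : ∀ x y → ∃[ g ] (G g × g x ≡ y)
    B-inv      : IsGInvPartition G SameBlock
    B-unique   : ∀ (R : Pt p → Pt p → Set) → IsGInvPartition G R →
                 NontrivialPartition R →
                 ∀ x y → (R x y → SameBlock x y) × (SameBlock x y → R x y)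
  K : Map p → Set
  K g = G g × (∀ x → blk (g x) ≡ blk x)
  field
    K≠1            : Nontrivial K
    K-no-derange   : ∀ k → K k → ∃[ x ] (k x ≡ x)
    K-minnormal    : ∀ (N : Map p → Set) → IsMinimalNormal G N → N ⊆ K →
                     IsElemAb3 N
    K-no-invol     : ∀ k → K k → k ∘ k ≈ idM → k ≈ idM
    Gbar-gen       : ∀ g → G g → ∃[ i ] ∃[ j ] (bar g ≈ (α p ^ i) ∘ (β ^ j))
    Gbar-AGL       : ∀ g → G g → ∃[ m ] ∃[ c ] (bar g ≈ affine p m c)
    β-fix          : β (0 mod p) ≡ 0 mod p
    β-order        : HasOrder β d
    d∣p-1          : d ∣ℕ (p ∸ 1)
    β-conj         : β ∘ α p ≈ (α p ^ t) ∘ β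
    t-coprime      : Coprime t p
    d-even         : 2 ∣ℕ d
    a∈G            : G (a p)
    b∈G            : G b
    b-image        : ∀ x → blk (b x) ≡ β (blk x)
    b-inverse      : IsInverse b b⁻¹
    b-transp       : RestrB1Transposition b

  Gab : Map p → Set
  Gab = Gen (λ f → K f ⊎ (f ≈ a p) ⊎ (f ≈ b))

-- The block action of every element of G(a,b) is an affine map i ↦ m i + c of ℤ/p; for
-- a^u b^v the slope is m = t^v, and m ≢ 1 (mod p) because β^v ≠ 1 when d ∤ v.  Since p is
-- prime, j (1 - m) + c ≡ 0 (mod p) has a solution j, and then g = a^j conjugates a^u b^v
-- to an element acting on the blocks exactly as b^v does.  Hence k = g a^u b^v g⁻¹ b^(-v)
-- lies in the kernel K, and g a^u b^v g⁻¹ = k b^v.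
module Submission where

open import Defs
open import Data.Nat using (ℕ; NonZero; suc; _+_; _*_; _%_; _/_; _<_; z≤n; s≤s; >-nonZero)
  renaming (_^_ to _^ℕ_)
open import Data.Fin using (Fin; toℕ)
open import Data.Integer using (ℤ; +_; -[1+_])
open import Data.Integer.Divisibility using (_∣_)
open import Data.Product using (∃-syntax; _×_; _,_; proj₁; proj₂; swap)
open import Relation.Nullary using (¬_)
open import Data.Nat.Properties using (*-zeroʳ; *-identityˡ; *-identityʳ; +-identityʳ; +-comm)
open import Data.Nat.DivMod
open import Data.Nat.Divisibility
  using (divides; ∣-refl; n∣m*n; ∣m⇒∣m*n; ∣m+n∣m⇒∣n; m%n≡0⇒n∣m)
  renaming (_∣_ to _∣ℕ_)
open import Data.Nat.GCD using (module Bézout)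
open import Data.Nat.Coprimality using (Coprime; coprime-Bézout)
open import Data.Nat.Primality using (Prime; prime⇒irreducible)
open import Data.Nat.Tactic.RingSolver using (solve)
open import Data.Fin.Properties using (toℕ-injective; toℕ-fromℕ<; toℕ<n)
open import Data.List using (_∷_; [])
open import Data.Sum using (inj₁; inj₂)
open import Data.Empty using (⊥-elim)
open import Function using (_∘′_)
open import Relation.Binary.PropositionalEquality

module _ {A : Set} where

  ^-sucʳ : (f : A → A) (n : ℕ) → f ^ suc n ≈ (f ^ n) ∘ f
  ^-sucʳ f 0       x = refl
  ^-sucʳ f (suc n) x = cong f (^-sucʳ f n x)

  ^-+ : (f : A → A) (m n : ℕ) → f ^ (m + n) ≈ (f ^ m) ∘ (f ^ n)
  ^-+ f 0       n x = refl
  ^-+ f (suc m) n x = cong f (^-+ f m n x)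

  ^-* : (f : A → A) (m n : ℕ) → f ^ (m * n) ≈ (f ^ n) ^ m
  ^-* f 0       n x = refl
  ^-* f (suc m) n x = trans (^-+ f n (m * n) x) (cong (f ^ n) (^-* f m n x))

  ^-idM : ∀ {f : A → A} → f ≈ idM → ∀ n → f ^ n ≈ idM
  ^-idM f≈id 0       x = refl
  ^-idM f≈id (suc n) x = trans (f≈id _) (^-idM f≈id n x)

  ^-leftInverse : ∀ {f g : A → A} → g ∘ f ≈ idM → ∀ n → (g ^ n) ∘ (f ^ n) ≈ idM
  ^-leftInverse         g∘f≈id 0       x = refl
  ^-leftInverse {f} {g} g∘f≈id (suc n) x =
    trans (^-sucʳ g n _) (trans (cong (g ^ n) (g∘f≈id _)) (^-leftInverse g∘f≈id n x))

  ^-inverse : ∀ {f g : A → A} → IsInverse f g → ∀ n → IsInverse (f ^ n) (g ^ n)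
  ^-inverse (g∘f≈id , f∘g≈id) n = ^-leftInverse g∘f≈id n , ^-leftInverse f∘g≈id n

  zpow-inverse : ∀ {f g : A → A} → IsInverse f g → ∀ z → IsInverse (zpow f g z) (zpow g f z)
  zpow-inverse f⁻¹ (+ n)    = ^-inverse f⁻¹ n
  zpow-inverse {f} {g} f⁻¹ -[1+ n ] = ^-inverse {g} {f} (swap f⁻¹) (suc n)

  module _ (H : (A → A) → Set) (H-idM : H idM)
           (H-∘ : ∀ {f g} → H f → H g → H (f ∘ g)) where

    ^-closed : ∀ {f} → H f → ∀ n → H (f ^ n)
    ^-closed f∈H 0       = H-idM
    ^-closed f∈H (suc n) = H-∘ f∈H (^-closed f∈H n)

    zpow-closed : ∀ {f g} → H f → H g → ∀ z → H (zpow f g z)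
    zpow-closed f∈H g∈H (+ n)    = ^-closed f∈H n
    zpow-closed f∈H g∈H -[1+ n ] = ^-closed g∈H (suc n)

  ^-%-period : ∀ {f : A → A} {d} .{{_ : NonZero d}} → f ^ d ≈ idM → ∀ n → f ^ n ≈ f ^ (n % d)
  ^-%-period {f} {d} fᵈ≈id n x = begin
    (f ^ n) x                           ≡⟨ cong (λ e → (f ^ e) x) (m≡m%n+[m/n]*n n d) ⟩
    (f ^ (n % d + n / d * d)) x         ≡⟨ ^-+ f (n % d) (n / d * d) x ⟩
    (f ^ (n % d)) ((f ^ (n / d * d)) x)
      ≡⟨ cong (f ^ (n % d)) (trans (^-* f (n / d) d x) (^-idM fᵈ≈id (n / d) x)) ⟩
    (f ^ (n % d)) x                     ∎
    where open ≡-Reasoning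

  order∣ : ∀ {f : A → A} {d n} → HasOrder f d → f ^ n ≈ idM → d ∣ℕ n
  order∣ {f} {d} {n} (d>0 , fᵈ≈id , minimal) fⁿ≈id =
    remainder-trivial⇒∣ (λ x → trans (sym (^-%-period fᵈ≈id n x)) (fⁿ≈id x))
    where
      instance _ = >-nonZero d>0
      remainder-trivial⇒∣ : f ^ (n % d) ≈ idM → d ∣ℕ n
      remainder-trivial⇒∣ with n % d in r≡
      ... | 0     = λ _ → m%n≡0⇒n∣m n d r≡
      ... | suc r = ⊥-elim ∘′ minimal (suc r) (s≤s z≤n) (subst (_< d) r≡ (m%n<n n d))

  conjugate : (A → A) → (A → A) → (A → A) → (A → A)
  conjugate g g⁻¹ f = g ∘ f ∘ g⁻¹

  conjugate-factor : ∀ {f g g⁻¹ h h⁻¹ : A → A} → g⁻¹ ∘ g ≈ idM → h⁻¹ ∘ h ≈ idM →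
                     g ∘ f ≈ ((conjugate g g⁻¹ f ∘ h⁻¹) ∘ h) ∘ g
  conjugate-factor {f} {g} {g⁻¹} g⁻¹∘g≈id h⁻¹∘h≈id x =
    sym (cong (λ y → g (f y)) (trans (cong g⁻¹ (h⁻¹∘h≈id _)) (g⁻¹∘g≈id x)))

  ^-semiconj : ∀ {B : Set} (π : A → B) {f : A → A} {φ : B → B} →
               (∀ x → π (f x) ≡ φ (π x)) → ∀ n x → π ((f ^ n) x) ≡ (φ ^ n) (π x)
  ^-semiconj π         π∘f≡φ∘π 0       x = refl
  ^-semiconj π {φ = φ} π∘f≡φ∘π (suc n) x =
    trans (π∘f≡φ∘π _) (cong φ (^-semiconj π π∘f≡φ∘π n x))

  module _ {B : Set} (π : A → B) {f g g⁻¹ h h⁻¹ : A → A} where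

    conjugate-∘-fibrewise : (∀ y → π (g (f y)) ≡ π (h (g y))) →
                            g ∘ g⁻¹ ≈ idM → h ∘ h⁻¹ ≈ idM →
                            ∀ x → π ((conjugate g g⁻¹ f ∘ h⁻¹) x) ≡ π x
    conjugate-∘-fibrewise gf≡hg g∘g⁻¹≈id h∘h⁻¹≈id x =
      trans (gf≡hg _) (cong π (trans (cong h (g∘g⁻¹≈id _)) (h∘h⁻¹≈id x)))

prime∤⇒coprime : ∀ {p w} → Prime p → ¬ p ∣ℕ w → Coprime w p
prime∤⇒coprime pr p∤w (i∣w , i∣p) with prime⇒irreducible pr i∣p
... | inj₁ i≡1 = i≡1
... | inj₂ refl = ⊥-elim (p∤w i∣w)

coprime⇒linear-congruence : ∀ {w n} → Coprime w (suc n) → ∀ c → ∃[ j ] (suc n ∣ℕ j * w + c)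
coprime⇒linear-congruence {w} {n} w⊥p c with coprime-Bézout w⊥p
... | Bézout.+- x y 1+yp≡xw = n * c * x , divides (c + n * c * y) (begin
  n * c * x * w + c         ≡⟨ solve (n ∷ c ∷ x ∷ w ∷ []) ⟩
  n * c * (x * w) + c       ≡⟨ cong (λ e → n * c * e + c) 1+yp≡xw ⟨
  n * c * (1 + y * suc n) + c ≡⟨ solve (n ∷ c ∷ y ∷ []) ⟩
  (c + n * c * y) * suc n   ∎)
  where open ≡-Reasoning
... | Bézout.-+ x y 1+xw≡yp = c * x , divides (c * y) (begin
  c * x * w + c   ≡⟨ solve (c ∷ x ∷ w ∷ []) ⟩
  c * (1 + x * w) ≡⟨ cong (c *_) 1+xw≡yp ⟩
  c * (y * suc n) ≡⟨ solve (c ∷ y ∷ n ∷ []) ⟩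
  c * y * suc n   ∎)
  where open ≡-Reasoning

module AffineMaps (p' : ℕ) where

  p : ℕ
  p = suc p'

  record IsAffine (m c : ℕ) (f : Fin p → Fin p) : Set where
    constructor mkAffine
    field formula : ∀ i → toℕ (f i) ≡ (m * toℕ i + c) % p
  open IsAffine public

  toℕ-mod : ∀ n → toℕ (n mod p) ≡ n % p
  toℕ-mod n = toℕ-fromℕ< _

  toℕ%p : (i : Fin p) → toℕ i % p ≡ toℕ i
  toℕ%p i = m<n⇒m%n≡m (toℕ<n i)

  toℕ-mod-inverse : (i : Fin p) → toℕ i mod p ≡ i
  toℕ-mod-inverse i = toℕ-injective (trans (toℕ-mod (toℕ i)) (toℕ%p i))

  [m*[x%p]+c]%p : ∀ m x c → (m * (x % p) + c) % p ≡ (m * x + c) % p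
  [m*[x%p]+c]%p m x c = begin
    (m * (x % p) + c) % p
      ≡⟨ %-distribˡ-+ (m * (x % p)) c p ⟩
    ((m * (x % p)) % p + c % p) % p
      ≡⟨ cong (λ e → (e + c % p) % p) (%-distribˡ-* m (x % p) p) ⟩
    ((m % p * (x % p % p)) % p + c % p) % p
      ≡⟨ cong (λ e → ((m % p * e) % p + c % p) % p) (m%n%n≡m%n x p) ⟩
    ((m % p * (x % p)) % p + c % p) % p
      ≡⟨ cong (λ e → (e + c % p) % p) (%-distribˡ-* m x p) ⟨
    ((m * x) % p + c % p) % p
      ≡⟨ %-distribˡ-+ (m * x) c p ⟨
    (m * x + c) % p
      ∎
    where open ≡-Reasoning

  idM-affine : IsAffine 1 0 idM
  idM-affine = mkAffine λ i →
    sym (trans (%-congˡ (trans (+-identityʳ _) (*-identityˡ (toℕ i)))) (toℕ%p i))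

  ∘-affine : ∀ {m₁ c₁ m₂ c₂ f g} → IsAffine m₁ c₁ f → IsAffine m₂ c₂ g →
             IsAffine (m₁ * m₂) (m₁ * c₂ + c₁) (f ∘ g)
  ∘-affine {m₁} {c₁} {m₂} {c₂} {f} {g} f-aff g-aff = mkAffine λ i → begin
    toℕ (f (g i))                           ≡⟨ formula f-aff (g i) ⟩
    (m₁ * toℕ (g i) + c₁) % p               ≡⟨ cong (λ e → (m₁ * e + c₁) % p) (formula g-aff i) ⟩
    (m₁ * ((m₂ * toℕ i + c₂) % p) + c₁) % p ≡⟨ [m*[x%p]+c]%p m₁ (m₂ * toℕ i + c₂) c₁ ⟩
    (m₁ * (m₂ * toℕ i + c₂) + c₁) % p       ≡⟨ %-congˡ (rearrange (toℕ i)) ⟩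
    (m₁ * m₂ * toℕ i + (m₁ * c₂ + c₁)) % p  ∎
    where
      open ≡-Reasoning
      rearrange : ∀ x → m₁ * (m₂ * x + c₂) + c₁ ≡ m₁ * m₂ * x + (m₁ * c₂ + c₁)
      rearrange x = solve (m₁ ∷ m₂ ∷ x ∷ c₂ ∷ c₁ ∷ [])

  ^-linear : ∀ {m f} → IsAffine m 0 f → ∀ n → IsAffine (m ^ℕ n) 0 (f ^ n)
  ^-linear f-lin 0       = idM-affine
  ^-linear {m} {f} f-lin (suc n) =
    subst (λ c → IsAffine (m ^ℕ suc n) c (f ^ suc n)) (trans (+-identityʳ (m * 0)) (*-zeroʳ m))
          (∘-affine f-lin (^-linear f-lin n))

  ^-translation : ∀ {c f} → IsAffine 1 c f → ∀ n → IsAffine 1 (n * c) (f ^ n)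
  ^-translation f-tr 0       = idM-affine
  ^-translation {c} {f} f-tr (suc n) =
    subst (λ e → IsAffine 1 e (f ^ suc n)) rearrange (∘-affine f-tr (^-translation f-tr n))
    where
      rearrange : 1 * (n * c) + c ≡ (1 + n) * c
      rearrange = solve (n ∷ c ∷ [])

  -- p ∣ m * p' + 1 expresses m ≡ 1 (mod p) without truncated subtraction.
  affine-trivial : ∀ {m c f} → IsAffine m c f → p ∣ℕ m * p' + 1 → p ∣ℕ c → f ≈ idM
  affine-trivial {m} {c} {f} f-aff p∣m-1 p∣c i = toℕ-injective (begin
    toℕ (f i)                         ≡⟨ formula f-aff i ⟩
    (m * x + c) % p                   ≡⟨ %-remove-+ʳ (m * x + c) (∣m⇒∣m*n x p∣m-1) ⟨
    (m * x + c + (m * p' + 1) * x) % p ≡⟨ %-congˡ (rearrange x) ⟩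
    (x + m * x * p + c) % p           ≡⟨ %-remove-+ʳ (x + m * x * p) p∣c ⟩
    (x + m * x * p) % p               ≡⟨ [m+kn]%n≡m%n x (m * x) p ⟩
    x % p                             ≡⟨ toℕ%p i ⟩
    x                                 ∎)
    where
      open ≡-Reasoning
      x = toℕ i
      rearrange : ∀ x → m * x + c + (m * p' + 1) * x ≡ x + m * x * (1 + p') + c
      rearrange x = solve (m ∷ x ∷ c ∷ p' ∷ [])

  nontrivial-linear⇒p∤m*p'+1 : ∀ {m f} → IsAffine m 0 f → ¬ f ≈ idM → ¬ p ∣ℕ m * p' + 1
  nontrivial-linear⇒p∤m*p'+1 f-lin f≉id p∣ = f≉id (affine-trivial f-lin p∣ (divides 0 refl))

  p∣1*p'+1 : p ∣ℕ 1 * p' + 1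
  p∣1*p'+1 = divides 1 rearrange
    where
      rearrange : 1 * p' + 1 ≡ 1 * (1 + p')
      rearrange = solve (p' ∷ [])

  -- The divisibility says e + c ≡ m e (mod p), the offsets of τ ψ φ and of φ τ.
  translation-conjugates-to-linear :
    ∀ {e c m τ ψ φ} → IsAffine 1 e τ → IsAffine 1 c ψ → IsAffine m 0 φ →
    p ∣ℕ e * (m * p' + 1) + c → τ ∘ ψ ∘ φ ≈ φ ∘ τ
  translation-conjugates-to-linear {e} {c} {m} {τ} {ψ} {φ} τ-tr ψ-tr φ-lin p∣ i = toℕ-injective (begin
    toℕ (τ (ψ (φ i)))
      ≡⟨ formula (∘-affine τ-tr (∘-affine ψ-tr φ-lin)) i ⟩
    (1 * (1 * m) * x + (1 * (1 * 0 + c) + e)) % p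
      ≡⟨ [m+kn]%n≡m%n (1 * (1 * m) * x + (1 * (1 * 0 + c) + e)) (m * e) p ⟨
    (1 * (1 * m) * x + (1 * (1 * 0 + c) + e) + m * e * p) % p
      ≡⟨ %-congˡ (rearrange x) ⟩
    (m * 1 * x + (m * e + 0) + (e * (m * p' + 1) + c)) % p
      ≡⟨ %-remove-+ʳ (m * 1 * x + (m * e + 0)) p∣ ⟩
    (m * 1 * x + (m * e + 0)) % p
      ≡⟨ formula (∘-affine φ-lin τ-tr) i ⟨
    toℕ (φ (τ i))
      ∎)
    where
      open ≡-Reasoning
      x = toℕ i
      rearrange : ∀ x → 1 * (1 * m) * x + (1 * (1 * 0 + c) + e) + m * e * (1 + p')
                        ≡ m * 1 * x + (m * e + 0) + (e * (m * p' + 1) + c)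
      rearrange x = solve (m ∷ x ∷ c ∷ e ∷ p' ∷ [])

  α-translation : IsAffine 1 1 (α p)
  α-translation = mkAffine λ i → trans (toℕ-mod (suc (toℕ i))) (%-congˡ (rearrange (toℕ i)))
    where
      rearrange : ∀ x → suc x ≡ 1 * x + 1
      rearrange x = solve (x ∷ [])

  α^-translation : ∀ j → IsAffine 1 j (α p ^ j)
  α^-translation j = subst (λ e → IsAffine 1 e (α p ^ j)) (*-identityʳ j) (^-translation α-translation j)

  α⁻¹ : Fin p → Fin p
  α⁻¹ i = (toℕ i + p') mod p

  α⁻¹-translation : IsAffine 1 p' α⁻¹
  α⁻¹-translation = mkAffine λ i →
    trans (toℕ-mod (toℕ i + p')) (%-congˡ (sym (cong (_+ p') (*-identityˡ (toℕ i)))))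

  suc-mod : ∀ n → suc n mod p ≡ α p (n mod p)
  suc-mod n = toℕ-injective (begin
    toℕ (suc n mod p)        ≡⟨ toℕ-mod (suc n) ⟩
    suc n % p                ≡⟨ %-congˡ (+-comm 1 n) ⟩
    (n + 1) % p              ≡⟨ cong (λ e → (e + 1) % p) (*-identityˡ n) ⟨
    (1 * n + 1) % p          ≡⟨ [m*[x%p]+c]%p 1 n 1 ⟨
    (1 * (n % p) + 1) % p    ≡⟨ cong (λ e → (1 * e + 1) % p) (toℕ-mod n) ⟨
    (1 * toℕ (n mod p) + 1) % p ≡⟨ formula α-translation (n mod p) ⟨
    toℕ (α p (n mod p))      ∎)
    where open ≡-Reasoning

  a-inverse : IsInverse (a p) (a⁻¹ p)
  a-inverse =
    (λ (c , i) → cong (c ,_) (translation-trivial (∘-affine α⁻¹-translation α-translation) ∣-refl i)) ,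
    (λ (c , i) → cong (c ,_) (translation-trivial (∘-affine α-translation α⁻¹-translation) p∣1*p'+1 i))
    where
      translation-trivial : ∀ {c f} → IsAffine 1 c f → p ∣ℕ c → f ≈ idM
      translation-trivial f-tr = affine-trivial f-tr p∣1*p'+1

module InSetting (p' d' t : ℕ) {G : Map (suc p') → Set} {b b⁻¹ : Map (suc p')}
                 {β : Fin (suc p') → Fin (suc p')}
                 (S : Setting (suc p') G b b⁻¹ β (suc d') t) where
  open AffineMaps p'
  open Setting S

  d : ℕ
  d = suc d'

  Induces : Map p → (Fin p → Fin p) → Set
  Induces f φ = ∀ x → blk (f x) ≡ φ (blk x)

  ^-induces : ∀ {f φ} → Induces f φ → ∀ n → Induces (f ^ n) (φ ^ n)
  ^-induces {f} {φ} = ^-semiconj blk {f} {φ}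

  a^-induces : ∀ n → Induces (a p ^ n) (α p ^ n)
  a^-induces = ^-induces {a p} {α p} (λ _ → refl)

  β-on-residues : ∀ n → toℕ (β (n mod p)) ≡ (t * n) % p
  β-on-residues 0       = trans (cong toℕ β-fix) (trans (toℕ-mod 0) (%-congˡ (sym (*-zeroʳ t))))
  β-on-residues (suc n) = begin
    toℕ (β (suc n mod p))           ≡⟨ cong (λ i → toℕ (β i)) (suc-mod n) ⟩
    toℕ (β (α p (n mod p)))         ≡⟨ cong toℕ (β-conj (n mod p)) ⟩
    toℕ ((α p ^ t) (β (n mod p)))   ≡⟨ formula (α^-translation t) (β (n mod p)) ⟩
    (1 * toℕ (β (n mod p)) + t) % p ≡⟨ cong (λ e → (1 * e + t) % p) (β-on-residues n) ⟩
    (1 * ((t * n) % p) + t) % p     ≡⟨ [m*[x%p]+c]%p 1 (t * n) t ⟩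
    (1 * (t * n) + t) % p           ≡⟨ %-congˡ (rearrange t n) ⟩
    (t * suc n) % p                 ∎
    where
      open ≡-Reasoning
      rearrange : ∀ t n → 1 * (t * n) + t ≡ t * suc n
      rearrange t n = solve (t ∷ n ∷ [])

  β-linear : IsAffine t 0 β
  β-linear = mkAffine λ i → begin
    toℕ (β i)               ≡⟨ cong (λ j → toℕ (β j)) (toℕ-mod-inverse i) ⟨
    toℕ (β (toℕ i mod p))   ≡⟨ β-on-residues (toℕ i) ⟩
    (t * toℕ i) % p         ≡⟨ %-congˡ (+-identityʳ (t * toℕ i)) ⟨
    (t * toℕ i + 0) % p     ∎
    where open ≡-Reasoning

  b⁻¹-induces : Induces b⁻¹ (β ^ d')
  b⁻¹-induces x = begin
    blk (b⁻¹ x)                ≡⟨ proj₁ (proj₂ β-order) _ ⟨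
    (β ^ d) (blk (b⁻¹ x))      ≡⟨ ^-sucʳ β d' _ ⟩
    (β ^ d') (β (blk (b⁻¹ x))) ≡⟨ cong (β ^ d') (b-image (b⁻¹ x)) ⟨
    (β ^ d') (blk (b (b⁻¹ x))) ≡⟨ cong (λ y → (β ^ d') (blk y)) (proj₂ b-inverse x) ⟩
    (β ^ d') (blk x)           ∎
    where open ≡-Reasoning

  β⁻¹^-nontrivial : ∀ n → ¬ d ∣ℕ suc n → ¬ (β ^ d') ^ suc n ≈ idM
  β⁻¹^-nontrivial n d∤ β⁻ⁿ≈id = d∤ (∣m+n∣m⇒∣n d∣nd'+n d∣nd')
    where
      d∣nd' : d ∣ℕ suc n * d'
      d∣nd' = order∣ β-order (λ x → trans (^-* β (suc n) d' x) (β⁻ⁿ≈id x))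
      d∣nd'+n : d ∣ℕ suc n * d' + suc n
      d∣nd'+n = subst (d ∣ℕ_) rearrange (n∣m*n (suc n))
        where
          rearrange : (1 + n) * (1 + d') ≡ (1 + n) * d' + (1 + n)
          rearrange = solve (n ∷ d' ∷ [])

  a^u-translation : ∀ u → ∃[ c ] ∃[ ψ ] (IsAffine 1 c ψ × Induces (zpow (a p) (a⁻¹ p) u) ψ)
  a^u-translation (+ n)    = n * 1 , α p ^ n , ^-translation α-translation n ,
                             a^-induces n
  a^u-translation -[1+ n ] = suc n * p' , α⁻¹ ^ suc n , ^-translation α⁻¹-translation (suc n) ,
                             ^-induces {a⁻¹ p} {α⁻¹} (λ _ → refl) (suc n)

  b^v-linear : ∀ v → ¬ (+ d ∣ v) →
               ∃[ m ] ∃[ φ ] (IsAffine m 0 φ × ¬ φ ≈ idM × Induces (zpow b b⁻¹ v) φ)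
  b^v-linear (+ n) d∤n = t ^ℕ n , β ^ n , ^-linear β-linear n ,
                         (λ βⁿ≈id → d∤n (order∣ β-order βⁿ≈id)) , ^-induces {b} {β} b-image n
  b^v-linear -[1+ n ] d∤ = (t ^ℕ d') ^ℕ suc n , (β ^ d') ^ suc n ,
                           ^-linear (^-linear β-linear d') (suc n) ,
                           β⁻¹^-nontrivial n d∤ , ^-induces {b⁻¹} b⁻¹-induces (suc n)

  open IsSubgroup G-subgroup using () renaming (mul to G-∘; one to G-idM; inv to G-inverse)

  zpow∈G : ∀ {f f⁻¹} → G f → IsInverse f f⁻¹ → ∀ z → G (zpow f f⁻¹ z)
  zpow∈G f∈G f⁻¹ = zpow-closed G G-idM G-∘ f∈G (G-inverse f∈G f⁻¹)

  conjugate-∘-inverse∈K : ∀ {f g g⁻¹ h h⁻¹} → G f → G g → G h →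
                          IsInverse g g⁻¹ → IsInverse h h⁻¹ →
                          (∀ y → blk (g (f y)) ≡ blk (h (g y))) → K (conjugate g g⁻¹ f ∘ h⁻¹)
  conjugate-∘-inverse∈K {f} {g} {g⁻¹} {h} {h⁻¹} f∈G g∈G h∈G g-inv h-inv gf≡hg =
    G-∘ (G-∘ g∈G (G-∘ f∈G (G-inverse g∈G g-inv))) (G-inverse h∈G h-inv) ,
    conjugate-∘-fibrewise blk {f} {g} {g⁻¹} {h} {h⁻¹} gf≡hg (proj₂ g-inv) (proj₂ h-inv)

  conjugate-into-kernel :
    ∀ u v → ¬ (+ d ∣ v) →
    ∃[ k ] (K k × ∃[ g ] (Gab g ×
      (g ∘ (zpow (a p) (a⁻¹ p) u ∘ zpow b b⁻¹ v) ≈ (k ∘ zpow b b⁻¹ v) ∘ g)))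
  conjugate-into-kernel u v d∤v with a^u-translation u | b^v-linear v d∤v
  ... | c , ψ , ψ-tr , A↦ψ | m , φ , φ-lin , φ≉id , B↦φ
    with coprime⇒linear-congruence (prime∤⇒coprime p-prime (nontrivial-linear⇒p∤m*p'+1 φ-lin φ≉id)) c
  ... | j , p∣ = k , k∈K , g , ^-closed Gab one mul (gen (inj₂ (inj₁ λ _ → refl))) j ,
                 conjugate-factor {f = A ∘ B} {g} {g⁻¹} {B} {B⁻¹} (proj₁ g-inverse) (proj₁ B-inverse)
    where
      A B B⁻¹ g g⁻¹ k : Map p
      A = zpow (a p) (a⁻¹ p) u
      B = zpow b b⁻¹ v
      B⁻¹ = zpow b⁻¹ b v
      g = a p ^ j
      g⁻¹ = a⁻¹ p ^ j
      k = conjugate g g⁻¹ (A ∘ B) ∘ B⁻¹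
      g-inverse : IsInverse g g⁻¹
      g-inverse = ^-inverse a-inverse j
      B-inverse : IsInverse B B⁻¹
      B-inverse = zpow-inverse b-inverse v
      B∈G : G B
      B∈G = zpow∈G b∈G b-inverse v
      g-commutes-on-blocks : ∀ y → blk (g (A (B y))) ≡ blk (B (g y))
      g-commutes-on-blocks y = begin
        blk (g (A (B y)))         ≡⟨ a^-induces j (A (B y)) ⟩
        (α p ^ j) (blk (A (B y))) ≡⟨ cong (α p ^ j) (trans (A↦ψ _) (cong ψ (B↦φ y))) ⟩
        (α p ^ j) (ψ (φ (blk y)))
          ≡⟨ translation-conjugates-to-linear (α^-translation j) ψ-tr φ-lin p∣ (blk y) ⟩
        φ ((α p ^ j) (blk y))     ≡⟨ cong φ (a^-induces j y) ⟨
        φ (blk (g y))             ≡⟨ B↦φ (g y) ⟨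
        blk (B (g y))             ∎
        where open ≡-Reasoning
      k∈K : K k
      k∈K = conjugate-∘-inverse∈K (G-∘ (zpow∈G a∈G a-inverse u) B∈G) (zpow∈G a∈G a-inverse (+ j))
                                  B∈G g-inverse B-inverse g-commutes-on-blocks

lemma7p4 : ∀ (p : ℕ) .{{_ : NonZero p}} (G : Map p → Set) (b b⁻¹ : Map p)
             (β : Fin p → Fin p) (d t : ℕ) (S : Setting p G b b⁻¹ β d t) →
             ∀ (u v : ℤ) → ¬ ((+ d) ∣ v) →
             ∃[ k ] (Setting.K S k ×
               ∃[ g ] (Setting.Gab S g ×
                 (g ∘ (zpow (a p) (a⁻¹ p) u ∘ zpow b b⁻¹ v)
                   ≈ (k ∘ zpow b b⁻¹ v) ∘ g)))
lemma7p4 0        G b b⁻¹ β d        t S with () ← Setting.p≥5 S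
lemma7p4 (suc p') G b b⁻¹ β 0        t S with () ← proj₁ (Setting.β-order S)
lemma7p4 (suc p') G b b⁻¹ β (suc d') t S = InSetting.conjugate-into-kernel p' d' t S
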